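{- A semicycle-free $k$-uniform hypergraph does not contain a self-intersecting chain as a subhypergraph.
   Context: Hypergraphs are finite, $k$-uniform and have no multiple edges. A nonempty $k$-uniform hypergraph $\mathcal{L}$ is a chain if there is a sequence $v_1,\dots,v_l$ of its vertices in which every vertex appears at least once (possibly several times), $v_1\neq v_l$, and the sets $\{v_i,\dots,v_{i+k-1}\}$ for $1\le i\le l-k+1$ are pairwise distinct edges of $\mathcal{L}$ and are exactly its edges; the chain is self-intersecting if some vertex appears at least twice in this defining sequence. A semicycle is defined in the same way as a chain except that $v_1=v_l$ is required instead of $v_1\ne v_l$. A hypergraph is semicycle-free if it contains no semicycle as a subhypergraph. -}

module Defs where

open import Level using (Level; _⊔_) renaming (suc to lsuc; zero to lzero)
open import Data.Nat using (ℕ; zero; suc; _+_; _≤_; _<_)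
open import Data.Fin using (Fin; toℕ; fromℕ) renaming (zero to fzero)
open import Data.Fin.Subset using (Subset; _∈_; _⊆_; ∣_∣)
open import Data.Product using (Σ; ∃; ∃-syntax; _×_; _,_)
open import Relation.Binary.PropositionalEquality using (_≡_; _≢_)
open import Relation.Nullary using (¬_)
open import Function.Bundles using (_⇔_)

-- A finite hypergraph whose vertices are drawn from Fin n.
-- V is its vertex set; E e holds iff e is an edge (so no multiple edges);
-- every edge consists of vertices of the hypergraph.
record Hypergraph (n : ℕ) : Set₁ where
  field
    V   : Subset n
    E   : Subset n → Set
    E⊆V : ∀ e → E e → e ⊆ V
open Hypergraph public

Uniform : {n : ℕ} → ℕ → Hypergraph n → Set
Uniform k H = ∀ e → E H e → ∣ e ∣ ≡ k

SubHypergraph : {n : ℕ} → Hypergraph n → Hypergraph n → Set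
SubHypergraph L H = (V L ⊆ V H) × (∀ e → E L e → E H e)

Nonempty : {n : ℕ} → Hypergraph n → Set
Nonempty H = ∃[ e ] E H e

-- A sequence v_1 ... v_l (0-indexed, l = suc m).
-- InWindow k v i x : x ∈ {v_i, ..., v_{i+k-1}}  (0-based i)
InWindow : {n m : ℕ} → ℕ → (Fin (suc m) → Fin n) → ℕ → Fin n → Set
InWindow {m = m} k v i x = ∃[ j ] (i ≤ toℕ j × toℕ j < i + k × v j ≡ x)

ValidStart : ℕ → ℕ → ℕ → Set
ValidStart m k i = i + k ≤ suc m

-- The sequence v defines L as in the definition of chain / semicycle
-- (apart from the condition on v_1 and v_l):
--  * its entries are exactly the vertices of L (each vertex appears);
--  * the windows are pairwise distinct sets;
--  * the edges of L are exactly the windows.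
Defines : {n m : ℕ} → ℕ → Hypergraph n → (Fin (suc m) → Fin n) → Set
Defines {n} {m} k L v =
    (∀ x → (x ∈ V L) ⇔ (∃[ j ] v j ≡ x))
  × (∀ i i′ → ValidStart m k i → ValidStart m k i′ → i ≢ i′ →
       ¬ (∀ x → InWindow k v i x ⇔ InWindow k v i′ x))
  × (∀ e → E L e ⇔ (∃[ i ] (ValidStart m k i × (∀ x → (x ∈ e) ⇔ InWindow k v i x))))

SelfIntersecting : {n m : ℕ} → (Fin (suc m) → Fin n) → Set
SelfIntersecting {m = m} v = ∃[ j ] ∃[ j′ ] (j ≢ j′ × v j ≡ v j′)

ChainSeq : {n m : ℕ} → ℕ → Hypergraph n → (Fin (suc m) → Fin n) → Set
ChainSeq {m = m} k L v = Defines k L v × v fzero ≢ v (fromℕ m)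

SemicycleSeq : {n m : ℕ} → ℕ → Hypergraph n → (Fin (suc m) → Fin n) → Set
SemicycleSeq {m = m} k L v = Defines k L v × v fzero ≡ v (fromℕ m)

IsChain : {n : ℕ} → ℕ → Hypergraph n → Set
IsChain {n} k L = Uniform k L × Nonempty L ×
  ∃[ m ] Σ (Fin (suc m) → Fin n) (λ v → ChainSeq k L v)

IsSelfIntersectingChain : {n : ℕ} → ℕ → Hypergraph n → Set
IsSelfIntersectingChain {n} k L = Uniform k L × Nonempty L ×
  ∃[ m ] Σ (Fin (suc m) → Fin n) (λ v → ChainSeq k L v × SelfIntersecting v)

IsSemicycle : {n : ℕ} → ℕ → Hypergraph n → Set
IsSemicycle {n} k L = Uniform k L × Nonempty L ×
  ∃[ m ] Σ (Fin (suc m) → Fin n) (λ v → SemicycleSeq k L v)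

SemicycleFree : {n : ℕ} → ℕ → Hypergraph n → Set₁
SemicycleFree {n} k H = ∀ (L : Hypergraph n) → SubHypergraph L H → ¬ IsSemicycle k L

-- A repeated vertex v_a = v_b (a < b) of a chain cuts out the segment v_a, …, v_b,
-- whose windows are windows of the chain; it therefore defines a semicycle inside
-- the chain.  The only thing to check is that the segment is long enough to carry
-- an edge: if b − a < k, some k-window of the chain would contain both positions
-- a and b and hence have fewer than k distinct vertices, contradicting uniformity.
module Submission where

open import Defs
open import Level using (Level)
open import Data.Nat using (ℕ; suc; _+_; _∸_; _≤_; _<_; s≤s)
open import Data.Nat.Properties
open import Data.Fin as Fin using (Fin; toℕ; fromℕ; fromℕ<; zero; suc)
open import Data.Fin.Properties using (toℕ-injective; toℕ-fromℕ<; toℕ-fromℕ; toℕ≤pred[n]; any?)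
open import Data.Fin.Subset using (Subset; inside; outside; _-_; ∣_∣) renaming (_∈_ to _∈ₛ_)
open import Data.Fin.Subset.Properties using (Empty-unique; ∣⊥∣≡0; p─q⊆p; p⊆q⇒∣p∣≤∣q∣; drop-there; x∈p∧x≢y⇒x∈p-y)
open import Data.Vec using (_∷_; tabulate; there)
open import Data.Vec.Properties using ([]=⇒lookup; lookup⇒[]=; lookup∘tabulate)
open import Data.Bool.Properties using (T-≡)
open import Data.List using (List; []; _∷_; map; filter; applyUpTo; length)
open import Data.List.Properties using (length-map; length-applyUpTo; filter-notAll)
open import Data.List.Membership.Propositional using () renaming (_∈_ to _∈ₗ_)
open import Data.List.Membership.Propositional.Properties using (∈-map⁺; ∈-filter⁺; ∈-applyUpTo⁺)
open import Data.List.Relation.Unary.Any as Any using (Any)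
open import Data.Product using (Σ-syntax; ∃-syntax; _×_; _,_; proj₂)
open import Data.Empty using (⊥-elim)
open import Relation.Nullary using (¬_; yes; no; ¬?; contradiction)
open import Relation.Nullary.Decidable using (⌊_⌋; _×-dec_; toWitness; fromWitness)
open import Relation.Unary using (Pred; Decidable)
open import Relation.Binary.PropositionalEquality
open import Relation.Binary.Definitions using (tri<; tri≈; tri>)
open import Function.Base using (_∘_; case_of_)
open import Function.Bundles using (_⇔_; mk⇔; Equivalence)
open Equivalence using (to; from)
open import Function.Properties.Equivalence using () renaming (refl to ⇔-refl; sym to ⇔-sym; trans to ⇔-trans)

private
  variable
    ℓ : Level
    n m k : ℕ

fromDec : {P : Pred (Fin n) ℓ} → Decidable P → Subset n
fromDec P? = tabulate (λ x → ⌊ P? x ⌋)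

∈-fromDec⇔ : {P : Pred (Fin n) ℓ} (P? : Decidable P) (x : Fin n) → (x ∈ₛ fromDec P?) ⇔ P x
∈-fromDec⇔ P? x = mk⇔
  (λ x∈ → toWitness (from T-≡ (trans (sym (lookup∘tabulate _ x)) ([]=⇒lookup x∈))))
  (λ px → lookup⇒[]= x _ (trans (lookup∘tabulate _ x) (to T-≡ (fromWitness px))))

∣p∣≤1+∣p-x∣ : ∀ (p : Subset n) x → ∣ p ∣ ≤ suc ∣ p - x ∣
∣p∣≤1+∣p-x∣ (s ∷ p) zero = ≤-trans (∣x∷p∣≤1+∣p∣ s p)
  (s≤s (p⊆q⇒∣p∣≤∣q∣ {p = p} λ y∈p → drop-there (x∈p∧x≢y⇒x∈p-y {p = s ∷ p} {y = zero} (there y∈p) λ ())))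
  where
  ∣x∷p∣≤1+∣p∣ : ∀ s (p : Subset _) → ∣ s ∷ p ∣ ≤ suc ∣ p ∣
  ∣x∷p∣≤1+∣p∣ inside  p = ≤-refl
  ∣x∷p∣≤1+∣p∣ outside p = n≤1+n ∣ p ∣
∣p∣≤1+∣p-x∣ (inside  ∷ p) (suc x) = s≤s (∣p∣≤1+∣p-x∣ p x)
∣p∣≤1+∣p-x∣ (outside ∷ p) (suc x) = ∣p∣≤1+∣p-x∣ p x

x∉p-x : ∀ {p : Subset n} x → ¬ (x ∈ₛ p - x)
x∉p-x {p = _ ∷ _} zero    ()
x∉p-x {p = _ ∷ _} (suc x) (there x∈) = x∉p-x x x∈

⊆list⇒∣p∣≤length : ∀ (xs : List (Fin n)) {p : Subset n} → (∀ {x} → x ∈ₛ p → x ∈ₗ xs) → ∣ p ∣ ≤ length xs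
⊆list⇒∣p∣≤length {n} [] p⊆[] =
  ≤-reflexive (trans (cong ∣_∣ (Empty-unique λ (_ , x∈p) → case p⊆[] x∈p of λ ())) (∣⊥∣≡0 n))
⊆list⇒∣p∣≤length (y ∷ ys) {p} p⊆y∷ys = ≤-trans (∣p∣≤1+∣p-x∣ p y) (s≤s (⊆list⇒∣p∣≤length ys p-y⊆ys))
  where
  p-y⊆ys : ∀ {x} → x ∈ₛ p - y → x ∈ₗ ys
  p-y⊆ys x∈ with p⊆y∷ys (p─q⊆p p _ x∈)
  ... | Any.here refl   = contradiction x∈ (x∉p-x y)
  ... | Any.there x∈ys = x∈ys

noninjective-window⇒∣p∣<k : (g : ℕ → Fin n) {i k a b : ℕ} →
  i ≤ a → a < b → b < i + k → g a ≡ g b →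
  {p : Subset n} → (∀ {x} → x ∈ₛ p → ∃[ q ] (i ≤ q × q < i + k × g q ≡ x)) → ∣ p ∣ < k
noninjective-window⇒∣p∣<k g {i} {k} {a} {b} i≤a a<b b<i+k ga≡gb {p} p⊆window = begin-strict
  ∣ p ∣                   ≤⟨ ⊆list⇒∣p∣≤length (map g others) p⊆others ⟩
  length (map g others)  ≡⟨ length-map g others ⟩
  length others          <⟨ filter-notAll (λ q → ¬? (q ≟ b)) interval b∈interval ⟩
  length interval        ≡⟨ length-applyUpTo (i +_) k ⟩
  k                      ∎
  where
  open ≤-Reasoning
  interval = applyUpTo (i +_) k
  others = filter (λ q → ¬? (q ≟ b)) interval

  ∈-interval : ∀ {q} → i ≤ q → q < i + k → q ∈ₗ interval
  ∈-interval {q} i≤q q<i+k = subst (_∈ₗ interval) (m+[n∸m]≡n i≤q)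
    (∈-applyUpTo⁺ (i +_) (+-cancelˡ-< i (q ∸ i) k (subst (_< i + k) (sym (m+[n∸m]≡n i≤q)) q<i+k)))

  b∈interval : Any (λ q → ¬ ¬ q ≡ b) interval
  b∈interval = Any.map (λ b≡q q≢b → q≢b (sym b≡q)) (∈-interval (≤-trans i≤a (<⇒≤ a<b)) b<i+k)

  -- position b carries the same vertex as position a, so it can be dropped
  p⊆others : ∀ {x} → x ∈ₛ p → x ∈ₗ map g others
  p⊆others x∈p with p⊆window x∈p
  ... | q , i≤q , q<i+k , refl with q ≟ b
  ... | yes refl = subst (_∈ₗ map g others) ga≡gb
                     (∈-map⁺ g (∈-filter⁺ _ (∈-interval i≤a (<-trans a<b b<i+k)) (<⇒≢ a<b)))
  ... | no q≢b   = ∈-map⁺ g (∈-filter⁺ _ (∈-interval i≤q q<i+k) q≢b)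

coveringWindowStart : ∀ {a b k l} → k ≤ l → b < l → b < a + k → ∃[ i ] (i ≤ a × i + k ≤ l × b < i + k)
coveringWindowStart {a} {b} {k} {l} k≤l b<l b<a+k with a + k ≤? l
... | yes a+k≤l = a , ≤-refl , a+k≤l , b<a+k
... | no  a+k≰l = l ∸ k , l∸k≤a , ≤-reflexive l∸k+k≡l , subst (b <_) (sym l∸k+k≡l) b<l
  where
  l∸k+k≡l : l ∸ k + k ≡ l
  l∸k+k≡l = m∸n+n≡m k≤l
  l∸k≤a : l ∸ k ≤ a
  l∸k≤a = <⇒≤ (+-cancelʳ-< k (l ∸ k) a (subst (_< a + k) (sym l∸k+k≡l) (≰⇒> a+k≰l)))

-- Position p of a sequence of length suc m; positions beyond the end give the junk value zero.
index : ℕ → Fin (suc m)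
index {m} p with p <? suc m
... | yes p<1+m = fromℕ< p<1+m
... | no  _     = zero

toℕ-index : ∀ {p} → p ≤ m → toℕ (index {m} p) ≡ p
toℕ-index {m} {p} p≤m with p <? suc m
... | yes p<1+m = toℕ-fromℕ< p<1+m
... | no  p≮1+m = contradiction (s≤s p≤m) p≮1+m

index-toℕ : (j : Fin (suc m)) → index (toℕ j) ≡ j
index-toℕ j = toℕ-injective (toℕ-index (toℕ≤pred[n] j))

InWindow? : ∀ k (v : Fin (suc m) → Fin n) i → Decidable (InWindow k v i)
InWindow? k v i x = any? λ j → (i ≤? toℕ j) ×-dec (toℕ j <? i + k) ×-dec (v j Fin.≟ x)

window : ∀ k → (Fin (suc m) → Fin n) → ℕ → Subset n
window k v i = fromDec (InWindow? k v i)

WindowEdge : ℕ → (Fin (suc m) → Fin n) → Subset n → Set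
WindowEdge {m} k v e = ∃[ i ] (ValidStart m k i × (∀ x → (x ∈ₛ e) ⇔ InWindow k v i x))

window-WindowEdge : ∀ k (v : Fin (suc m) → Fin n) {i} → ValidStart m k i → WindowEdge k v (window k v i)
window-WindowEdge k v {i} valid = i , valid , ∈-fromDec⇔ (InWindow? k v i)

DistinctWindows : ℕ → (Fin (suc m) → Fin n) → Set
DistinctWindows {m} k v = ∀ i i′ → ValidStart m k i → ValidStart m k i′ → i ≢ i′ →
  ¬ (∀ x → InWindow k v i x ⇔ InWindow k v i′ x)

repeat⇒k≤gap : {L : Hypergraph n} {v : Fin (suc m) → Fin n} → Uniform k L → Nonempty L → Defines k L v →
  {j j′ : Fin (suc m)} → toℕ j < toℕ j′ → v j ≡ v j′ → k ≤ suc (toℕ j′ ∸ toℕ j)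
repeat⇒k≤gap {m = m} {k = k} {v = v} uniform (e , e∈L) (_ , _ , edges) {j} {j′} a<b va≡vb
  with k ≤? suc (toℕ j′ ∸ toℕ j)
... | yes k≤gap = k≤gap
... | no  k≰gap = ⊥-elim (no-window-contains-a-and-b (coveringWindowStart k≤1+m (s≤s (toℕ≤pred[n] j′)) b<a+k))
  where
  a = toℕ j
  b = toℕ j′

  b<a+k : b < a + k
  b<a+k = subst (_< a + k) (m+[n∸m]≡n (<⇒≤ a<b)) (+-monoʳ-< a (<-trans (n<1+n _) (≰⇒> k≰gap)))

  k≤1+m : k ≤ suc m
  k≤1+m with i₀ , i₀+k≤1+m , _ ← to (edges e) e∈L = ≤-trans (m≤n+m k i₀) i₀+k≤1+m

  v[a]≡v[b] : v (index a) ≡ v (index b)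
  v[a]≡v[b] rewrite index-toℕ j | index-toℕ j′ = va≡vb

  window⊆ : ∀ {i x} → x ∈ₛ window k v i → ∃[ q ] (i ≤ q × q < i + k × v (index q) ≡ x)
  window⊆ {i} {x} x∈ with j″ , i≤j″ , j″<i+k , v[j″]≡x ← to (∈-fromDec⇔ (InWindow? k v i) x) x∈ =
    toℕ j″ , i≤j″ , j″<i+k , trans (cong v (index-toℕ j″)) v[j″]≡x

  no-window-contains-a-and-b : ¬ (∃[ i ] (i ≤ a × i + k ≤ suc m × b < i + k))
  no-window-contains-a-and-b (i , i≤a , i+k≤1+m , b<i+k) =
    <⇒≢ (noninjective-window⇒∣p∣<k (v ∘ index) i≤a a<b b<i+k v[a]≡v[b] window⊆)
        (uniform (window k v i) (from (edges _) (window-WindowEdge k v i+k≤1+m)))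

entries : (Fin (suc m) → Fin n) → Subset n
entries v = fromDec λ x → any? λ j → v j Fin.≟ x

∈-entries⇔ : (v : Fin (suc m) → Fin n) (x : Fin n) → (x ∈ₛ entries v) ⇔ (∃[ j ] v j ≡ x)
∈-entries⇔ v = ∈-fromDec⇔ λ x → any? λ j → v j Fin.≟ x

windowHypergraph : ℕ → (Fin (suc m) → Fin n) → Hypergraph n
windowHypergraph k v = record
  { V   = entries v
  ; E   = WindowEdge k v
  ; E⊆V = λ { e (i , _ , e≡window) {x} x∈e →
              let j , _ , _ , vj≡x = to (e≡window x) x∈e in from (∈-entries⇔ v x) (j , vj≡x) }
  }

windowHypergraph-defines : ∀ k (v : Fin (suc m) → Fin n) → DistinctWindows k v → Defines k (windowHypergraph k v) v
windowHypergraph-defines k v distinct = ∈-entries⇔ v , distinct , λ e → ⇔-refl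

module Segment (v : Fin (suc m) → Fin n) {a m′ : ℕ} (a+m′≤m : a + m′ ≤ m) where

  segment : Fin (suc m′) → Fin n
  segment t = v (index (a + toℕ t))

  ValidStart-segment : ∀ {i} → ValidStart m′ k i → ValidStart m k (a + i)
  ValidStart-segment {k} {i} i+k≤1+m′ = begin
    a + i + k     ≡⟨ +-assoc a i k ⟩
    a + (i + k)   ≤⟨ +-monoʳ-≤ a i+k≤1+m′ ⟩
    a + suc m′    ≡⟨ +-suc a m′ ⟩
    suc (a + m′)  ≤⟨ s≤s a+m′≤m ⟩
    suc m         ∎
    where open ≤-Reasoning

  InWindow-segment⇔ : ∀ {i} → ValidStart m′ k i → ∀ x → InWindow k segment i x ⇔ InWindow k v (a + i) x
  InWindow-segment⇔ {k} {i} i+k≤1+m′ x = mk⇔ shift unshift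
    where
    shift : InWindow k segment i x → InWindow k v (a + i) x
    shift (t , i≤t , t<i+k , segment[t]≡x) =
        index (a + toℕ t)
      , subst (a + i ≤_) (sym a+t) (+-monoʳ-≤ a i≤t)
      , subst (_< a + i + k) (sym a+t) (subst (a + toℕ t <_) (sym (+-assoc a i k)) (+-monoʳ-< a t<i+k))
      , segment[t]≡x
      where
      a+t : toℕ (index {m} (a + toℕ t)) ≡ a + toℕ t
      a+t = toℕ-index (≤-trans (+-monoʳ-≤ a (toℕ≤pred[n] t)) a+m′≤m)

    unshift : InWindow k v (a + i) x → InWindow k segment i x
    unshift (j , a+i≤j , j<a+i+k , vj≡x) = index q , i≤t , t<i+k , segment[t]≡x
      where
      q = toℕ j ∸ a
      a+q≡j : a + q ≡ toℕ j
      a+q≡j = m+[n∸m]≡n (≤-trans (m≤m+n a i) a+i≤j)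
      i≤q : i ≤ q
      i≤q = +-cancelˡ-≤ a i q (subst (a + i ≤_) (sym a+q≡j) a+i≤j)
      q<i+k : q < i + k
      q<i+k = +-cancelˡ-< a q (i + k) (subst₂ _<_ (sym a+q≡j) (+-assoc a i k) j<a+i+k)
      t≡q : toℕ (index {m′} q) ≡ q
      t≡q = toℕ-index (≤-pred (≤-trans q<i+k i+k≤1+m′))
      i≤t = subst (i ≤_) (sym t≡q) i≤q
      t<i+k = subst (_< i + k) (sym t≡q) q<i+k
      segment[t]≡x : segment (index q) ≡ x
      segment[t]≡x = begin
        v (index (a + toℕ (index q))) ≡⟨ cong (v ∘ index ∘ (a +_)) t≡q ⟩
        v (index (a + q))             ≡⟨ cong (v ∘ index) a+q≡j ⟩
        v (index (toℕ j))             ≡⟨ cong v (index-toℕ j) ⟩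
        v j                           ≡⟨ vj≡x ⟩
        x                             ∎
        where open ≡-Reasoning

  WindowEdge-segment : ∀ {e} → WindowEdge k segment e → WindowEdge k v e
  WindowEdge-segment (i , valid , e≡window) =
    a + i , ValidStart-segment valid , λ x → ⇔-trans (e≡window x) (InWindow-segment⇔ valid x)

  DistinctWindows-segment : DistinctWindows k v → DistinctWindows k segment
  DistinctWindows-segment distinct i i′ valid valid′ i≢i′ same-window =
    distinct (a + i) (a + i′) (ValidStart-segment valid) (ValidStart-segment valid′) (i≢i′ ∘ +-cancelˡ-≡ a i i′)
      λ x → ⇔-trans (⇔-sym (InWindow-segment⇔ valid x)) (⇔-trans (same-window x) (InWindow-segment⇔ valid′ x))

  windowHypergraph-segment⊆ : {L : Hypergraph n} → Defines k L v → SubHypergraph (windowHypergraph k segment) L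
  windowHypergraph-segment⊆ {k} (entries-L , _ , edges) =
      (λ {x} x∈ → let t , segment[t]≡x = to (∈-entries⇔ segment x) x∈ in from (entries-L x) (_ , segment[t]≡x))
    , λ e → from (edges e) ∘ WindowEdge-segment {k}

SubHypergraph-trans : {L M H : Hypergraph n} → SubHypergraph L M → SubHypergraph M H → SubHypergraph L H
SubHypergraph-trans (VL⊆VM , EL⊆EM) (VM⊆VH , EM⊆EH) = VM⊆VH ∘ VL⊆VM , λ e → EM⊆EH e ∘ EL⊆EM e

ContainsSemicycle : ℕ → Hypergraph n → Set₁
ContainsSemicycle {n} k L = Σ[ L′ ∈ Hypergraph n ] (SubHypergraph L′ L × IsSemicycle k L′)

repeat⇒semicycle : {L : Hypergraph n} {v : Fin (suc m) → Fin n} → Uniform k L → Nonempty L → Defines k L v →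
  {j j′ : Fin (suc m)} → toℕ j < toℕ j′ → v j ≡ v j′ → ContainsSemicycle k L
repeat⇒semicycle {m = m} {k = k} {L} {v} uniform nonempty defines@(_ , distinct , _) {j} {j′} a<b va≡vb =
    windowHypergraph k segment
  , L′⊆L
  , (λ e e∈L′ → uniform e (proj₂ L′⊆L e e∈L′))
  , (window k segment 0 , window-WindowEdge k segment (repeat⇒k≤gap {L = L} uniform nonempty defines a<b va≡vb))
  , m′ , segment , windowHypergraph-defines k segment (DistinctWindows-segment {k} distinct) , closed
  where
  a = toℕ j
  b = toℕ j′
  m′ = b ∸ a

  a+m′≡b : a + m′ ≡ b
  a+m′≡b = m+[n∸m]≡n (<⇒≤ a<b)

  open Segment v {a} {m′} (subst (_≤ m) (sym a+m′≡b) (toℕ≤pred[n] j′))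

  L′⊆L : SubHypergraph (windowHypergraph k segment) L
  L′⊆L = windowHypergraph-segment⊆ {k = k} {L = L} defines

  closed : segment zero ≡ segment (fromℕ m′)
  closed = begin
    v (index (a + 0))               ≡⟨ cong (v ∘ index) (+-identityʳ a) ⟩
    v (index a)                     ≡⟨ cong v (index-toℕ j) ⟩
    v j                             ≡⟨ va≡vb ⟩
    v j′                            ≡⟨ cong v (index-toℕ j′) ⟨
    v (index b)                     ≡⟨ cong (v ∘ index) a+m′≡b ⟨
    v (index (a + m′))              ≡⟨ cong (v ∘ index ∘ (a +_)) (toℕ-fromℕ m′) ⟨
    v (index (a + toℕ (fromℕ m′)))  ∎
    where open ≡-Reasoning

selfIntersectingChain⇒semicycle : {L : Hypergraph n} → IsSelfIntersectingChain k L → ContainsSemicycle k L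
selfIntersectingChain⇒semicycle {L = L} (uniform , nonempty , _ , _ , (defines , _) , j , j′ , j≢j′ , vj≡vj′)
  with <-cmp (toℕ j) (toℕ j′)
... | tri< j<j′ _ _ = repeat⇒semicycle {L = L} uniform nonempty defines j<j′ vj≡vj′
... | tri≈ _ j≡j′ _ = contradiction (toℕ-injective j≡j′) j≢j′
... | tri> _ _ j′<j = repeat⇒semicycle {L = L} uniform nonempty defines j′<j (sym vj≡vj′)

mainTheorem5 : (n k : ℕ) (H : Hypergraph n) → Uniform k H → SemicycleFree k H →
    ∀ (L : Hypergraph n) → SubHypergraph L H → ¬ IsSelfIntersectingChain k L
mainTheorem5 n k H _ semicycleFree L L⊆H chain
  with L′ , L′⊆L , semicycle ← selfIntersectingChain⇒semicycle {L = L} chain =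
  semicycleFree L′ (SubHypergraph-trans {L = L′} {M = L} {H = H} L′⊆L L⊆H) semicycle
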